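{- Let $M=(a_{ij})$ be a real $p\times q$ matrix and let $k\ge 1$. Let $\rho$ be either $\gamma_{s,m}$ for some column index $s$ and some nonzero integer $m$, or $\epsilon_{s,l,h}$ for some distinct column indices $s,l$ and some integer $h$. Suppose that every $k\times k$ minor of $M$ whose row set contains the first row is an integer. Then every $k\times k$ minor of $\rho(M)$ whose row set contains the first row (i.e. the minor of $\rho(M)$ with the same row set $I\ni 1$ and same column set $J$ as a minor of $M$ of this kind) is an integer.
   Context: For a matrix $M$: $\gamma_{s,m}(M)$ is the matrix obtained from $M$ by multiplying its first row by $m$ and multiplying its $s$-th column by $\frac1m$ (so the entry in position $(1,s)$ is unchanged). $\epsilon_{s,l,h}(M)$ is the matrix obtained from $M$ by adding $h$ times its $s$-th column to its $l$-th column. -}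

module Defs where

open import Level using (Level; _⊔_)
open import Algebra.Bundles using (CommutativeRing)
open import Data.Nat using (ℕ; zero; suc)
open import Data.Integer using (ℤ; +_; -[1+_])
open import Data.Fin using (Fin; zero; suc; toℕ; punchIn; _<_)
open import Relation.Binary.PropositionalEquality using (_≡_; _≢_)
open import Relation.Nullary using (yes; no)
open import Data.Fin.Properties using (_≟_)
open import Data.Product using (∃; Σ)

-- Strictly increasing index maps: a k-element subset of Fin n, listed in order.
StrictlyIncreasing : ∀ {k n} → (Fin k → Fin n) → Set
StrictlyIncreasing {k} I = (a b : Fin k) → a < b → I a < I b

module MatrixOps {c ℓ : Level} (R : CommutativeRing c ℓ) where
  open CommutativeRing R using (Carrier; _≈_; _+_; _*_; -_; 0#; 1#)

  Matrix : ℕ → ℕ → Set c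
  Matrix p q = Fin p → Fin q → Carrier

  ιℕ : ℕ → Carrier
  ιℕ zero = 0#
  ιℕ (suc n) = 1# + ιℕ n

  ι : ℤ → Carrier
  ι (+ n) = ιℕ n
  ι (-[1+ n ]) = - ιℕ (suc n)

  IsInteger : Carrier → Set ℓ
  IsInteger x = Σ ℤ (λ z → x ≈ ι z)

  Σᶠ : ∀ {n} → (Fin n → Carrier) → Carrier
  Σᶠ {zero} f = 0#
  Σᶠ {suc n} f = f zero + Σᶠ (λ i → f (suc i))

  altSign : ℕ → Carrier
  altSign zero = 1#
  altSign (suc n) = - altSign n

  det : ∀ {n} → Matrix n n → Carrier
  det {zero} M = 1#
  det {suc n} M =
    Σᶠ (λ j → altSign (toℕ j) * (M zero j * det (λ a b → M (suc a) (punchIn j b))))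

  minor : ∀ {p q k} → Matrix p q → (Fin k → Fin p) → (Fin k → Fin q) → Carrier
  minor M I J = det (λ a b → M (I a) (J b))

  -- γ_{s,m}: first row times m, s-th column times m⁻¹ (given as u with m·u = 1)
  γ : ∀ {p q} → Fin q → ℤ → Carrier → Matrix (suc p) q → Matrix (suc p) q
  γ s m u M i j = rowF i * (M i j * colF j)
    where
      rowF : Fin _ → Carrier
      rowF zero = ι m
      rowF (suc _) = 1#
      colF : Fin _ → Carrier
      colF j with j ≟ s
      ... | yes _ = u
      ... | no _ = 1#

  ε : ∀ {p q} → Fin q → Fin q → ℤ → Matrix p q → Matrix p q
  ε s l h M i j with j ≟ l
  ... | yes _ = M i j + ι h * M i s
  ... | no _ = M i j

  data ColOp (q : ℕ) : Set (c ⊔ ℓ) where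
    gammaOp : (s : Fin q) (m : ℤ) → m ≢ + 0 → (u : Carrier) → ι m * u ≈ 1# → ColOp q
    epsOp   : (s l : Fin q) → s ≢ l → (h : ℤ) → ColOp q

  apply : ∀ {p q} → ColOp q → Matrix (suc p) q → Matrix (suc p) q
  apply (gammaOp s m _ u _) M = γ s m u M
  apply (epsOp s l _ h) M = ε s l h M

  FirstRowMinorsIntegral : ∀ {p q} → ℕ → Matrix (suc p) q → Set ℓ
  FirstRowMinorsIntegral {p} {q} k M =
    (I : Fin k → Fin (suc p)) (J : Fin k → Fin q) →
    StrictlyIncreasing I → StrictlyIncreasing J →
    ∃ (λ a → I a ≡ zero) → IsInteger (minor M I J)

-- Fix a row set I ∋ 1 and read the minors as determinants of the rows I of M.
-- Scaling the first row by m and column s by 1/m multiplies the minor with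
-- column set J by m if s ∉ J and leaves it unchanged if s ∈ J. Adding h times
-- column s to column l ∈ J adds, by linearity in column l, h times the
-- determinant with column l replaced by column s; that determinant vanishes if
-- s ∈ J and is otherwise, up to sign, the minor with column set (J ∖ {l}) ∪ {s}
-- and the same rows, hence an integer.
module Submission where

open import Defs
open import Level using (Level)
open import Algebra.Bundles using (CommutativeRing)
open import Data.Nat using (ℕ; suc; _≥_)

open import Data.Nat as ℕ using (zero; z≤n; s≤s)
import Data.Nat.Properties as ℕ
open import Data.Fin using (Fin; zero; suc; toℕ; punchIn; punchOut; _<_)
open import Data.Fin.Properties
  using (_≟_; any?; <-cmp; punchIn-injective; punchInᵢ≢i; punchIn-punchOut; punchIn-cancel-≤)
open import Data.Vec.Functional using (_∷_; insertAt; updateAt)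
open import Data.Vec.Functional.Properties
  using (insertAt-lookup; insertAt-punchIn; updateAt-updates; updateAt-minimal)
open import Data.Integer using (ℤ; +_; -[1+_])
open import Data.Product using (∃; ∃₂; _,_; _×_)
open import Function using (_∘_; const)
open import Relation.Binary.PropositionalEquality as ≡ using (_≡_; _≢_)
open import Relation.Binary.Definitions using (tri<; tri≈; tri>)
open import Relation.Nullary using (yes; no; contradiction)
import Algebra.Solver.Ring.NaturalCoefficients.Default as NaturalCoefficients
import Algebra.Properties.Ring as RingProperties

strictlyIncreasing⇒injective : ∀ {k q} {J : Fin k → Fin q} → StrictlyIncreasing J →
  ∀ {a b} → J a ≡ J b → a ≡ b
strictlyIncreasing⇒injective {J = J} inc {a} {b} e with <-cmp a b
... | tri< a<b _ _ = contradiction (≡.subst (J a <_) (≡.sym e) (inc a b a<b)) (ℕ.<-irrefl ≡.refl)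
... | tri≈ _ a≡b _ = a≡b
... | tri> _ _ b<a = contradiction (≡.subst (_< J a) (≡.sym e) (inc b a b<a)) (ℕ.<-irrefl ≡.refl)

strictlyIncreasing-tail≢zero : ∀ {k p} {I : Fin (suc k) → Fin (suc p)} → StrictlyIncreasing I →
  ∀ a → I (suc a) ≢ zero
strictlyIncreasing-tail≢zero {I = I} inc a e =
  ℕ.n≮0 (≡.subst (I zero <_) e (inc zero (suc a) (s≤s z≤n)))

strictlyIncreasing-head≡zero : ∀ {k p} {I : Fin (suc k) → Fin (suc p)} → StrictlyIncreasing I →
  ∃ (λ a → I a ≡ zero) → I zero ≡ zero
strictlyIncreasing-head≡zero inc (zero , e) = e
strictlyIncreasing-head≡zero inc (suc a , e) = contradiction e (strictlyIncreasing-tail≢zero inc a)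

strictlyIncreasing-∷ : ∀ {n q} {f : Fin (suc n) → Fin q} →
  (∀ b → f zero < f (suc b)) → StrictlyIncreasing (f ∘ suc) → StrictlyIncreasing f
strictlyIncreasing-∷ head< inc zero    zero    ()
strictlyIncreasing-∷ head< inc zero    (suc b) _         = head< b
strictlyIncreasing-∷ head< inc (suc a) zero    ()
strictlyIncreasing-∷ head< inc (suc a) (suc b) (s≤s a<b) = inc a b a<b

punchIn-mono-< : ∀ {n} (i : Fin (suc n)) (a b : Fin n) → a < b → punchIn i a < punchIn i b
punchIn-mono-< i a b a<b = ℕ.≰⇒> (λ le → ℕ.<⇒≱ a<b (punchIn-cancel-≤ i b a le))

insertAt-lowerBound : ∀ {n q} {x v : Fin q} (xs : Fin n → Fin q) → x < v → (∀ j → x < xs j) →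
  ∀ i b → x < insertAt xs i v b
insertAt-lowerBound         xs x<v x<xs zero    zero    = x<v
insertAt-lowerBound         xs x<v x<xs zero    (suc b) = x<xs b
insertAt-lowerBound {zero}  xs x<v x<xs (suc ()) b
insertAt-lowerBound {suc n} xs x<v x<xs (suc i) zero    = x<xs zero
insertAt-lowerBound {suc n} xs x<v x<xs (suc i) (suc b) = insertAt-lowerBound (xs ∘ suc) x<v (x<xs ∘ suc) i b

insertAt-strictlyIncreasing : ∀ {n q} (s : Fin q) (L : Fin n → Fin q) → StrictlyIncreasing L →
  (∀ t → L t ≢ s) → ∃ λ t → StrictlyIncreasing (insertAt L t s)
insertAt-strictlyIncreasing {zero} s L inc s∉L = zero , λ { zero zero () }
insertAt-strictlyIncreasing {suc n} s L inc s∉L with <-cmp s (L zero)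
... | tri< s<L₀ _ _ = zero , strictlyIncreasing-∷ s<L inc
  where
    s<L : ∀ b → s < L b
    s<L zero    = s<L₀
    s<L (suc b) = ℕ.<-trans s<L₀ (inc zero (suc b) (s≤s z≤n))
... | tri≈ _ s≡L₀ _ = contradiction (≡.sym s≡L₀) (s∉L zero)
... | tri> _ _ L₀<s with insertAt-strictlyIncreasing s (L ∘ suc) (λ a b a<b → inc (suc a) (suc b) (s≤s a<b)) (s∉L ∘ suc)
...   | t , inc′ = suc t , strictlyIncreasing-∷ L₀<insert inc′
  where
    L₀<insert : ∀ b → L zero < insertAt (L ∘ suc) t s b
    L₀<insert = insertAt-lowerBound (L ∘ suc) L₀<s (λ j → inc zero (suc j) (s≤s z≤n)) t

toFront : ∀ {n} → Fin (suc n) → Fin (suc n) → Fin (suc n)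
toFront b = b ∷ punchIn b

-- b′ is the position of b once index punchIn b j is deleted; the last component
-- is the parity bookkeeping of the Laplace signs.
punchIn-toFront : ∀ {n} (b : Fin (suc (suc n))) (j : Fin (suc n)) → ∃ λ b′ →
  (∀ c → toFront b (punchIn (suc j) c) ≡ punchIn (punchIn b j) (toFront b′ c)) ×
  suc (toℕ j ℕ.+ toℕ b′) ≡ toℕ b ℕ.+ toℕ (punchIn b j)
punchIn-toFront zero j =
  zero , (λ { zero → ≡.refl ; (suc c) → ≡.refl }) , ≡.cong suc (ℕ.+-identityʳ (toℕ j))
punchIn-toFront (suc b) zero =
  b , (λ { zero → ≡.refl ; (suc c) → ≡.refl }) , ≡.cong suc (≡.sym (ℕ.+-identityʳ (toℕ b)))
punchIn-toFront {zero} (suc b) (suc ())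
punchIn-toFront {suc n} (suc b) (suc j) with punchIn-toFront b j
... | b′ , commute , parity = suc b′ , commute′ , parity′
  where
    commute′ : ∀ c → toFront (suc b) (punchIn (suc (suc j)) c) ≡
                     punchIn (suc (punchIn b j)) (toFront (suc b′) c)
    commute′ zero          = ≡.cong suc (commute zero)
    commute′ (suc zero)    = ≡.refl
    commute′ (suc (suc c)) = ≡.cong suc (commute (suc c))
    open ≡.≡-Reasoning
    parity′ : suc (suc (toℕ j) ℕ.+ suc (toℕ b′)) ≡ suc (toℕ b) ℕ.+ suc (toℕ (punchIn b j))
    parity′ = begin
      suc (suc (toℕ j ℕ.+ suc (toℕ b′)))   ≡⟨ ≡.cong (λ x → suc (suc x)) (ℕ.+-suc (toℕ j) (toℕ b′)) ⟩
      suc (suc (suc (toℕ j ℕ.+ toℕ b′)))   ≡⟨ ≡.cong (λ x → suc (suc x)) parity ⟩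
      suc (suc (toℕ b ℕ.+ toℕ (punchIn b j))) ≡⟨ ≡.cong suc (≡.sym (ℕ.+-suc (toℕ b) (toℕ (punchIn b j)))) ⟩
      suc (toℕ b ℕ.+ suc (toℕ (punchIn b j))) ∎

module _ {c ℓ : Level} (R : CommutativeRing c ℓ) where
  open CommutativeRing R hiding (zero)
  open MatrixOps R
  open import Relation.Binary.Reasoning.Setoid setoid
  open NaturalCoefficients commutativeSemiring using (solve; _:=_; _:+_; _:*_)
  open RingProperties ring using (-‿distribˡ-*; -‿distribʳ-*; -‿involutive; -0#≈0#; -‿+-comm)

  ≡⇒≈ : ∀ {x y} → x ≡ y → x ≈ y
  ≡⇒≈ ≡.refl = refl

  altSign-square : ∀ n → altSign n * altSign n ≈ 1#
  altSign-square zero    = *-identityˡ 1#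
  altSign-square (suc n) = begin
    (- altSign n) * (- altSign n) ≈⟨ -‿distribˡ-* _ _ ⟨
    - (altSign n * (- altSign n)) ≈⟨ -‿cong (-‿distribʳ-* _ _) ⟨
    - - (altSign n * altSign n)   ≈⟨ -‿involutive _ ⟩
    altSign n * altSign n         ≈⟨ altSign-square n ⟩
    1#                            ∎

  altSign-+ : ∀ m n → altSign (m ℕ.+ n) ≈ altSign m * altSign n
  altSign-+ zero    n = sym (*-identityˡ _)
  altSign-+ (suc m) n = trans (-‿cong (altSign-+ m n)) (-‿distribˡ-* _ _)

  Σᶠ-cong : ∀ {n} {f g : Fin n → Carrier} → (∀ i → f i ≈ g i) → Σᶠ f ≈ Σᶠ g
  Σᶠ-cong {zero}  f≈g = refl
  Σᶠ-cong {suc n} f≈g = +-cong (f≈g zero) (Σᶠ-cong (f≈g ∘ suc))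

  Σᶠ-zero : ∀ {n} {f : Fin n → Carrier} → (∀ i → f i ≈ 0#) → Σᶠ f ≈ 0#
  Σᶠ-zero {zero}  f≈0 = refl
  Σᶠ-zero {suc n} f≈0 = trans (+-cong (f≈0 zero) (Σᶠ-zero (f≈0 ∘ suc))) (+-identityˡ 0#)

  Σᶠ-*ˡ : ∀ {n} x (f : Fin n → Carrier) → Σᶠ (λ i → x * f i) ≈ x * Σᶠ f
  Σᶠ-*ˡ {zero}  x f = sym (zeroʳ x)
  Σᶠ-*ˡ {suc n} x f = trans (+-congˡ (Σᶠ-*ˡ x (f ∘ suc))) (sym (distribˡ x _ _))

  Σᶠ-linear : ∀ {n} x y (f g : Fin n → Carrier) →
    Σᶠ (λ i → x * f i + y * g i) ≈ x * Σᶠ f + y * Σᶠ g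
  Σᶠ-linear {zero}  x y f g = sym (trans (+-cong (zeroʳ x) (zeroʳ y)) (+-identityˡ 0#))
  Σᶠ-linear {suc n} x y f g = begin
    (x * f zero + y * g zero) + Σᶠ (λ i → x * f (suc i) + y * g (suc i))
      ≈⟨ +-congˡ (Σᶠ-linear x y (f ∘ suc) (g ∘ suc)) ⟩
    (x * f zero + y * g zero) + (x * Σᶠ (f ∘ suc) + y * Σᶠ (g ∘ suc))
      ≈⟨ solve 6 (λ x y a b c d → (x :* a :+ y :* b) :+ (x :* c :+ y :* d) := x :* (a :+ c) :+ y :* (b :+ d))
               refl x y (f zero) (g zero) (Σᶠ (f ∘ suc)) (Σᶠ (g ∘ suc)) ⟩
    x * Σᶠ f + y * Σᶠ g ∎

  Σᶠ-punchIn : ∀ {n} (f : Fin (suc n) → Carrier) b → Σᶠ f ≈ f b + Σᶠ (f ∘ punchIn b)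
  Σᶠ-punchIn          f zero    = refl
  Σᶠ-punchIn {zero}  f (suc ())
  Σᶠ-punchIn {suc n} f (suc b) = begin
    f zero + Σᶠ (f ∘ suc)                            ≈⟨ +-congˡ (Σᶠ-punchIn (f ∘ suc) b) ⟩
    f zero + (f (suc b) + Σᶠ (f ∘ suc ∘ punchIn b))  ≈⟨ solve 3 (λ a b c → a :+ (b :+ c) := b :+ (a :+ c))
                                                              refl (f zero) (f (suc b)) (Σᶠ (f ∘ suc ∘ punchIn b)) ⟩
    f (suc b) + (f zero + Σᶠ (f ∘ suc ∘ punchIn b))  ∎

  columns : ∀ {n q k} → Matrix n q → (Fin k → Fin q) → Matrix n k
  columns A J a b = A a (J b)

  delete₀ : ∀ {n} → Matrix (suc n) (suc n) → Fin (suc n) → Matrix n n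
  delete₀ A j a b = A (suc a) (punchIn j b)

  laplaceTerm : ∀ {n} → Matrix (suc n) (suc n) → Fin (suc n) → Carrier
  laplaceTerm A j = altSign (toℕ j) * (A zero j * det (delete₀ A j))

  det-cong : ∀ {n} {A B : Matrix n n} → (∀ a b → A a b ≈ B a b) → det A ≈ det B
  det-cong {zero}  A≈B = refl
  det-cong {suc n} {A} {B} A≈B =
    Σᶠ-cong {f = laplaceTerm A} {g = laplaceTerm B}
      (λ j → *-congˡ (*-cong (A≈B zero j) (det-cong (λ a b → A≈B (suc a) (punchIn j b)))))

  det-scaleRow₀ : ∀ {n} (A B : Matrix (suc n) (suc n)) x → (∀ b → A zero b ≈ x * B zero b) →
    (∀ a b → A (suc a) b ≈ B (suc a) b) → det A ≈ x * det B
  det-scaleRow₀ A B x row₀ rows = trans (Σᶠ-cong term≈) (Σᶠ-*ˡ x (laplaceTerm B))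
    where
      term≈ : ∀ j → laplaceTerm A j ≈ x * laplaceTerm B j
      term≈ j = begin
        altSign (toℕ j) * (A zero j * det (delete₀ A j))
          ≈⟨ *-congˡ (*-cong (row₀ j) (det-cong (λ a b → rows a (punchIn j b)))) ⟩
        altSign (toℕ j) * ((x * B zero j) * det (delete₀ B j))
          ≈⟨ solve 4 (λ s x b d → s :* ((x :* b) :* d) := x :* (s :* (b :* d)))
                   refl (altSign (toℕ j)) x (B zero j) (det (delete₀ B j)) ⟩
        x * laplaceTerm B j ∎

  det-linearColumn : ∀ {n} (A B C : Matrix n n) (j : Fin n) x y →
    (∀ a b → b ≢ j → A a b ≈ B a b) → (∀ a b → b ≢ j → A a b ≈ C a b) →
    (∀ a → A a j ≈ x * B a j + y * C a j) → det A ≈ x * det B + y * det C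
  det-linearColumn {zero}  A B C () x y A≈B A≈C colⱼ
  det-linearColumn {suc n} A B C j x y A≈B A≈C colⱼ =
    trans (Σᶠ-cong term≈) (Σᶠ-linear x y (laplaceTerm B) (laplaceTerm C))
    where
      term≈ : ∀ i → laplaceTerm A i ≈ x * laplaceTerm B i + y * laplaceTerm C i
      term≈ i with i ≟ j
      ... | yes ≡.refl = begin
        altSign (toℕ i) * (A zero i * det (delete₀ A i))
          ≈⟨ *-congˡ (*-congʳ (colⱼ zero)) ⟩
        altSign (toℕ i) * ((x * B zero i + y * C zero i) * det (delete₀ A i))
          ≈⟨ solve 6 (λ s x y b c d → s :* ((x :* b :+ y :* c) :* d) := x :* (s :* (b :* d)) :+ y :* (s :* (c :* d)))
                   refl (altSign (toℕ i)) x y (B zero i) (C zero i) (det (delete₀ A i)) ⟩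
        x * (altSign (toℕ i) * (B zero i * det (delete₀ A i))) + y * (altSign (toℕ i) * (C zero i * det (delete₀ A i)))
          ≈⟨ +-cong (*-congˡ (*-congˡ (*-congˡ (det-cong (λ a b → A≈B (suc a) (punchIn i b) (punchInᵢ≢i i b))))))
                    (*-congˡ (*-congˡ (*-congˡ (det-cong (λ a b → A≈C (suc a) (punchIn i b) (punchInᵢ≢i i b)))))) ⟩
        x * laplaceTerm B i + y * laplaceTerm C i ∎
      ... | no i≢j = begin
        altSign (toℕ i) * (A zero i * det (delete₀ A i))
          ≈⟨ *-congˡ (*-congˡ minor-linear) ⟩
        altSign (toℕ i) * (A zero i * (x * det (delete₀ B i) + y * det (delete₀ C i)))
          ≈⟨ solve 6 (λ s x y a b c → s :* (a :* (x :* b :+ y :* c)) := x :* (s :* (a :* b)) :+ y :* (s :* (a :* c)))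
                   refl (altSign (toℕ i)) x y (A zero i) (det (delete₀ B i)) (det (delete₀ C i)) ⟩
        x * (altSign (toℕ i) * (A zero i * det (delete₀ B i))) + y * (altSign (toℕ i) * (A zero i * det (delete₀ C i)))
          ≈⟨ +-cong (*-congˡ (*-congˡ (*-congʳ (A≈B zero i i≢j)))) (*-congˡ (*-congˡ (*-congʳ (A≈C zero i i≢j)))) ⟩
        x * laplaceTerm B i + y * laplaceTerm C i ∎
        where
          j′ : Fin n
          j′ = punchOut i≢j
          punchIn≢j : ∀ b → b ≢ j′ → punchIn i b ≢ j
          punchIn≢j b b≢j′ e =
            b≢j′ (punchIn-injective i b j′ (≡.trans e (≡.sym (punchIn-punchOut i≢j))))
          minor-linear : det (delete₀ A i) ≈ x * det (delete₀ B i) + y * det (delete₀ C i)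
          minor-linear = det-linearColumn (delete₀ A i) (delete₀ B i) (delete₀ C i) j′ x y
            (λ a b b≢j′ → A≈B (suc a) (punchIn i b) (punchIn≢j b b≢j′))
            (λ a b b≢j′ → A≈C (suc a) (punchIn i b) (punchIn≢j b b≢j′))
            (λ a → ≡.subst (λ z → A (suc a) z ≈ x * B (suc a) z + y * C (suc a) z)
                           (≡.sym (punchIn-punchOut i≢j)) (colⱼ (suc a)))

  det-scaleColumn : ∀ {n} (A B : Matrix n n) (j : Fin n) x →
    (∀ a b → b ≢ j → A a b ≈ B a b) → (∀ a → A a j ≈ x * B a j) → det A ≈ x * det B
  det-scaleColumn A B j x A≈B colⱼ = begin
    det A                       ≈⟨ det-linearColumn A B B j x 0# A≈B A≈B colⱼ′ ⟩
    x * det B + 0# * det B      ≈⟨ +-congˡ (zeroˡ _) ⟩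
    x * det B + 0#              ≈⟨ +-identityʳ _ ⟩
    x * det B                   ∎
    where
      colⱼ′ : ∀ a → A a j ≈ x * B a j + 0# * B a j
      colⱼ′ a = trans (colⱼ a) (sym (trans (+-congˡ (zeroˡ _)) (+-identityʳ _)))

  det-equalColumns₀₁ : ∀ {n} (A : Matrix (suc (suc n)) (suc (suc n))) →
    (∀ a → A a zero ≈ A a (suc zero)) → det A ≈ 0#
  det-equalColumns₀₁ {n} A col₀≈col₁ = begin
    laplaceTerm A zero + (laplaceTerm A (suc zero) + Σᶠ (λ j → laplaceTerm A (suc (suc j))))
      ≈⟨ +-congˡ (trans (+-congˡ (Σᶠ-zero {f = λ j → laplaceTerm A (suc (suc j))} (laterTerms n A col₀≈col₁))) (+-identityʳ _)) ⟩
    1# * (A zero zero * det (delete₀ A zero)) + (- 1#) * (A zero (suc zero) * det (delete₀ A (suc zero)))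
      ≈⟨ +-cong (*-identityˡ _) (trans (sym (-‿distribˡ-* _ _)) (-‿cong (*-identityˡ _))) ⟩
    A zero zero * det (delete₀ A zero) + - (A zero (suc zero) * det (delete₀ A (suc zero)))
      ≈⟨ +-congˡ (-‿cong (*-cong (col₀≈col₁ zero) (det-cong delete₀≈delete₁))) ⟨
    A zero zero * det (delete₀ A zero) + - (A zero zero * det (delete₀ A zero))
      ≈⟨ -‿inverseʳ _ ⟩
    0# ∎
    where
      delete₀≈delete₁ : ∀ a b → delete₀ A zero a b ≈ delete₀ A (suc zero) a b
      delete₀≈delete₁ a zero    = sym (col₀≈col₁ (suc a))
      delete₀≈delete₁ a (suc b) = refl
      laterTerms : ∀ n (A : Matrix (suc (suc n)) (suc (suc n))) → (∀ a → A a zero ≈ A a (suc zero)) →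
        ∀ j → laplaceTerm A (suc (suc j)) ≈ 0#
      laterTerms zero    A col₀≈col₁ ()
      laterTerms (suc n) A col₀≈col₁ j =
        trans (*-congˡ (trans (*-congˡ (det-equalColumns₀₁ (delete₀ A (suc (suc j))) (col₀≈col₁ ∘ suc)))
                              (zeroʳ _)))
              (zeroʳ _)

  det-toFront : ∀ {n} (A : Matrix (suc n) (suc n)) b →
    det (columns A (toFront b)) ≈ altSign (toℕ b) * det A
  det-toFront {zero}  A zero     = sym (*-identityˡ _)
  det-toFront {zero}  A (suc ())
  det-toFront {suc n} A b = begin
    laplaceTerm A′ zero + Σᶠ (laplaceTerm A′ ∘ suc)
      ≈⟨ +-cong frontTerm (Σᶠ-cong laterTerm) ⟩
    sᵇ * laplaceTerm A b + Σᶠ (λ j → sᵇ * laplaceTerm A (punchIn b j))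
      ≈⟨ +-congˡ (Σᶠ-*ˡ sᵇ (laplaceTerm A ∘ punchIn b)) ⟩
    sᵇ * laplaceTerm A b + sᵇ * Σᶠ (laplaceTerm A ∘ punchIn b)
      ≈⟨ distribˡ _ _ _ ⟨
    sᵇ * (laplaceTerm A b + Σᶠ (laplaceTerm A ∘ punchIn b))
      ≈⟨ *-congˡ (Σᶠ-punchIn (laplaceTerm A) b) ⟨
    sᵇ * det A ∎
    where
      sᵇ = altSign (toℕ b)
      A′ = columns A (toFront b)
      frontTerm : laplaceTerm A′ zero ≈ sᵇ * laplaceTerm A b
      frontTerm = begin
        1# * (A zero b * det (delete₀ A b))         ≈⟨ *-congʳ (altSign-square (toℕ b)) ⟨
        (sᵇ * sᵇ) * (A zero b * det (delete₀ A b))  ≈⟨ *-assoc _ _ _ ⟩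
        sᵇ * laplaceTerm A b                         ∎
      laterTerm : ∀ j → laplaceTerm A′ (suc j) ≈ sᵇ * laplaceTerm A (punchIn b j)
      laterTerm j with punchIn-toFront b j
      ... | b′ , commute , parity = begin
        altSign (suc (toℕ j)) * (A zero i * det (delete₀ A′ (suc j)))
          ≈⟨ *-congˡ (*-congˡ (trans (det-cong (λ a c → ≡⇒≈ (≡.cong (A (suc a)) (commute c))))
                                     (det-toFront (delete₀ A i) b′))) ⟩
        altSign (suc (toℕ j)) * (A zero i * (altSign (toℕ b′) * det (delete₀ A i)))
          ≈⟨ solve 4 (λ s t x d → s :* (x :* (t :* d)) := (s :* t) :* (x :* d))
                   refl (altSign (suc (toℕ j))) (altSign (toℕ b′)) (A zero i) (det (delete₀ A i)) ⟩
        (altSign (suc (toℕ j)) * altSign (toℕ b′)) * (A zero i * det (delete₀ A i))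
          ≈⟨ *-congʳ (altSign-+ (suc (toℕ j)) (toℕ b′)) ⟨
        altSign (suc (toℕ j ℕ.+ toℕ b′)) * (A zero i * det (delete₀ A i))
          ≈⟨ *-congʳ (≡⇒≈ (≡.cong altSign parity)) ⟩
        altSign (toℕ b ℕ.+ toℕ i) * (A zero i * det (delete₀ A i))
          ≈⟨ *-congʳ (altSign-+ (toℕ b) (toℕ i)) ⟩
        (sᵇ * altSign (toℕ i)) * (A zero i * det (delete₀ A i))
          ≈⟨ *-assoc _ _ _ ⟩
        sᵇ * laplaceTerm A i ∎
        where
          i = punchIn b j

  det-fromFront : ∀ {n} (A : Matrix (suc n) (suc n)) b →
    det A ≈ altSign (toℕ b) * det (columns A (toFront b))
  det-fromFront A b = begin
    det A                                        ≈⟨ *-identityˡ _ ⟨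
    1# * det A                                   ≈⟨ *-congʳ (altSign-square (toℕ b)) ⟨
    (altSign (toℕ b) * altSign (toℕ b)) * det A  ≈⟨ *-assoc _ _ _ ⟩
    altSign (toℕ b) * (altSign (toℕ b) * det A)  ≈⟨ *-congˡ (det-toFront A b) ⟨
    altSign (toℕ b) * det (columns A (toFront b)) ∎

  det-equalColumns : ∀ {n} (A : Matrix (suc n) (suc n)) t →
    (∀ a → A a zero ≈ A a (suc t)) → det A ≈ 0#
  det-equalColumns {zero}  A () col₀≈colₜ
  det-equalColumns {suc n} A t col₀≈colₜ = begin
    det A                                                    ≈⟨ det-fromFront A (suc t) ⟩
    altSign (toℕ (suc t)) * det (columns A (toFront (suc t))) ≈⟨ *-congˡ (det-equalColumns₀₁ (columns A (toFront (suc t))) (sym ∘ col₀≈colₜ)) ⟩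
    altSign (toℕ (suc t)) * 0#                               ≈⟨ zeroʳ _ ⟩
    0#                                                       ∎

  -- Integers as differences of naturals: closure under the ring operations
  -- then only needs ιℕ to preserve + and *, with no case analysis on ℤ.
  Integral : Carrier → Set ℓ
  Integral x = ∃₂ λ a b → x + ιℕ b ≈ ιℕ a

  ιℕ-+ : ∀ m n → ιℕ (m ℕ.+ n) ≈ ιℕ m + ιℕ n
  ιℕ-+ zero    n = sym (+-identityˡ _)
  ιℕ-+ (suc m) n = trans (+-congˡ (ιℕ-+ m n)) (sym (+-assoc _ _ _))

  ιℕ-* : ∀ m n → ιℕ (m ℕ.* n) ≈ ιℕ m * ιℕ n
  ιℕ-* zero    n = sym (zeroˡ _)
  ιℕ-* (suc m) n = begin
    ιℕ (n ℕ.+ m ℕ.* n)        ≈⟨ ιℕ-+ n (m ℕ.* n) ⟩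
    ιℕ n + ιℕ (m ℕ.* n)       ≈⟨ +-cong (sym (*-identityˡ _)) (ιℕ-* m n) ⟩
    1# * ιℕ n + ιℕ m * ιℕ n   ≈⟨ distribʳ _ _ _ ⟨
    (1# + ιℕ m) * ιℕ n        ∎

  ιℕ-sub : ∀ a b → ∃ λ z → ιℕ a + - ιℕ b ≈ ι z
  ιℕ-sub zero    zero    = + 0 , trans (+-congˡ -0#≈0#) (+-identityʳ _)
  ιℕ-sub (suc a) zero    = + suc a , trans (+-congˡ -0#≈0#) (+-identityʳ _)
  ιℕ-sub zero    (suc b) = -[1+ b ] , +-identityˡ _
  ιℕ-sub (suc a) (suc b) with ιℕ-sub a b
  ... | z , a-b≈z = z , (begin
    (1# + ιℕ a) + - (1# + ιℕ b)  ≈⟨ +-congˡ (-‿+-comm 1# (ιℕ b)) ⟨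
    (1# + ιℕ a) + (- 1# + - ιℕ b) ≈⟨ solve 4 (λ w x y z → (w :+ x) :+ (y :+ z) := (w :+ y) :+ (x :+ z))
                                           refl 1# (ιℕ a) (- 1#) (- ιℕ b) ⟩
    (1# + - 1#) + (ιℕ a + - ιℕ b) ≈⟨ +-congʳ (-‿inverseʳ 1#) ⟩
    0# + (ιℕ a + - ιℕ b)          ≈⟨ +-identityˡ _ ⟩
    ιℕ a + - ιℕ b                 ≈⟨ a-b≈z ⟩
    ι z                           ∎)

  Integral-resp : ∀ {x y} → x ≈ y → Integral x → Integral y
  Integral-resp x≈y (a , b , x+b≈a) = a , b , trans (+-congʳ (sym x≈y)) x+b≈a

  Integral-ι : ∀ z → Integral (ι z)
  Integral-ι (+ n)      = n , 0 , +-identityʳ _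
  Integral-ι (-[1+ n ]) = 0 , suc n , -‿inverseˡ _

  Integral-+ : ∀ {x y} → Integral x → Integral y → Integral (x + y)
  Integral-+ {x} {y} (a , b , x+b≈a) (c , d , y+d≈c) = a ℕ.+ c , b ℕ.+ d , (begin
    (x + y) + ιℕ (b ℕ.+ d)    ≈⟨ +-congˡ (ιℕ-+ b d) ⟩
    (x + y) + (ιℕ b + ιℕ d)   ≈⟨ solve 4 (λ x y b d → (x :+ y) :+ (b :+ d) := (x :+ b) :+ (y :+ d))
                                       refl x y (ιℕ b) (ιℕ d) ⟩
    (x + ιℕ b) + (y + ιℕ d)   ≈⟨ +-cong x+b≈a y+d≈c ⟩
    ιℕ a + ιℕ c               ≈⟨ ιℕ-+ a c ⟨
    ιℕ (a ℕ.+ c)              ∎)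

  Integral-* : ∀ {x y} → Integral x → Integral y → Integral (x * y)
  Integral-* {x} {y} (a , b , x+b≈a) (c , d , y+d≈c) = a ℕ.* c ℕ.+ b ℕ.* d , a ℕ.* d ℕ.+ b ℕ.* c , (begin
    x * y + ιℕ (a ℕ.* d ℕ.+ b ℕ.* c)
      ≈⟨ +-congˡ (trans (ιℕ-+ (a ℕ.* d) (b ℕ.* c)) (+-cong (ιℕ-* a d) (ιℕ-* b c))) ⟩
    x * y + (ιℕ a * ιℕ d + ιℕ b * ιℕ c)
      ≈⟨ +-congˡ (+-cong (*-congʳ x+b≈a) (*-congˡ y+d≈c)) ⟨
    x * y + ((x + ιℕ b) * ιℕ d + ιℕ b * (y + ιℕ d))
      ≈⟨ solve 4 (λ x y b d → x :* y :+ ((x :+ b) :* d :+ b :* (y :+ d)) := (x :+ b) :* (y :+ d) :+ b :* d)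
               refl x y (ιℕ b) (ιℕ d) ⟩
    (x + ιℕ b) * (y + ιℕ d) + ιℕ b * ιℕ d
      ≈⟨ +-cong (*-cong x+b≈a y+d≈c) (sym (ιℕ-* b d)) ⟩
    ιℕ a * ιℕ c + ιℕ (b ℕ.* d)
      ≈⟨ trans (+-congʳ (sym (ιℕ-* a c))) (sym (ιℕ-+ (a ℕ.* c) (b ℕ.* d))) ⟩
    ιℕ (a ℕ.* c ℕ.+ b ℕ.* d) ∎)

  Integral-‿ : ∀ {x} → Integral x → Integral (- x)
  Integral-‿ {x} (a , b , x+b≈a) = b , a , (begin
    - x + ιℕ a        ≈⟨ +-congˡ x+b≈a ⟨
    - x + (x + ιℕ b)  ≈⟨ +-assoc _ _ _ ⟨
    (- x + x) + ιℕ b  ≈⟨ +-congʳ (-‿inverseˡ x) ⟩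
    0# + ιℕ b         ≈⟨ +-identityˡ _ ⟩
    ιℕ b              ∎)

  Integral-altSign : ∀ n → Integral (altSign n)
  Integral-altSign zero    = 1 , 0 , refl
  Integral-altSign (suc n) = Integral-‿ (Integral-altSign n)

  IsInteger⇒Integral : ∀ {x} → IsInteger x → Integral x
  IsInteger⇒Integral (z , x≈z) = Integral-resp (sym x≈z) (Integral-ι z)

  Integral⇒IsInteger : ∀ {x} → Integral x → IsInteger x
  Integral⇒IsInteger {x} (a , b , x+b≈a) with ιℕ-sub a b
  ... | z , a-b≈z = z , (begin
    x                     ≈⟨ +-identityʳ x ⟨
    x + 0#                ≈⟨ +-congˡ (-‿inverseʳ (ιℕ b)) ⟨
    x + (ιℕ b + - ιℕ b)   ≈⟨ +-assoc _ _ _ ⟨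
    (x + ιℕ b) + - ιℕ b   ≈⟨ +-congʳ x+b≈a ⟩
    ιℕ a + - ιℕ b         ≈⟨ a-b≈z ⟩
    ι z                   ∎)

  ColumnMinorsIntegral : ∀ {n q} → Matrix n q → Set ℓ
  ColumnMinorsIntegral {n} {q} A =
    (J : Fin n → Fin q) → StrictlyIncreasing J → Integral (det (columns A J))

  -- A repeated column gives 0; otherwise sorting s into place costs the sign of det-toFront.
  ColumnMinorsIntegral-∷ : ∀ {n q} (A : Matrix (suc n) q) → ColumnMinorsIntegral A →
    ∀ s (L : Fin n → Fin q) → StrictlyIncreasing L → Integral (det (columns A (s ∷ L)))
  ColumnMinorsIntegral-∷ A minors s L inc with any? (λ t → L t ≟ s)
  ... | yes (t , Lₜ≡s) =
    Integral-resp (sym (det-equalColumns (columns A (s ∷ L)) t (λ a → ≡⇒≈ (≡.cong (A a) (≡.sym Lₜ≡s))))) (Integral-ι (+ 0))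
  ... | no s∉L with insertAt-strictlyIncreasing s L inc (λ t Lₜ≡s → s∉L (t , Lₜ≡s))
  ...   | t , inc′ = Integral-resp (sym det≈) (Integral-* (Integral-altSign (toℕ t)) (minors _ inc′))
    where
      sorted : ∀ a c → columns A (s ∷ L) a c ≈ columns A (insertAt L t s) a (toFront t c)
      sorted a zero    = ≡⇒≈ (≡.cong (A a) (≡.sym (insertAt-lookup L t s)))
      sorted a (suc c) = ≡⇒≈ (≡.cong (A a) (≡.sym (insertAt-punchIn L t s c)))
      det≈ : det (columns A (s ∷ L)) ≈ altSign (toℕ t) * det (columns A (insertAt L t s))
      det≈ = trans (det-cong sorted) (det-toFront (columns A (insertAt L t s)) t)

  ColumnMinorsIntegral-updateAt : ∀ {n q} (A : Matrix (suc n) q) → ColumnMinorsIntegral A →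
    ∀ (J : Fin (suc n) → Fin q) → StrictlyIncreasing J →
    ∀ b s → Integral (det (columns A (updateAt J b (const s))))
  ColumnMinorsIntegral-updateAt A minors J inc b s =
    Integral-resp (sym det≈)
      (Integral-* (Integral-altSign (toℕ b))
                  (ColumnMinorsIntegral-∷ A minors s (J ∘ punchIn b) (λ x y x<y → inc _ _ (punchIn-mono-< b x y x<y))))
    where
      moved : ∀ a c → columns A (updateAt J b (const s)) a (toFront b c) ≈ columns A (s ∷ J ∘ punchIn b) a c
      moved a zero    = ≡⇒≈ (≡.cong (A a) (updateAt-updates b J))
      moved a (suc c) = ≡⇒≈ (≡.cong (A a) (updateAt-minimal (punchIn b c) b J (punchInᵢ≢i b c)))
      det≈ : det (columns A (updateAt J b (const s))) ≈ altSign (toℕ b) * det (columns A (s ∷ J ∘ punchIn b))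
      det≈ = trans (det-fromFront (columns A (updateAt J b (const s))) b) (*-congˡ (det-cong moved))

  ε-offColumn : ∀ {n q} (s l : Fin q) h (A : Matrix n q) a j → j ≢ l → ε s l h A a j ≡ A a j
  ε-offColumn s l h A a j j≢l with j ≟ l
  ... | yes j≡l = contradiction j≡l j≢l
  ... | no _    = ≡.refl

  ε-onColumn : ∀ {n q} (s l : Fin q) h (A : Matrix n q) a → ε s l h A a l ≈ A a l + ι h * A a s
  ε-onColumn s l h A a with l ≟ l
  ... | yes _   = refl
  ... | no l≢l  = contradiction ≡.refl l≢l

  ε-columnMinorsIntegral : ∀ {n q} (s l : Fin q) h (A : Matrix (suc n) q) →
    ColumnMinorsIntegral A → ColumnMinorsIntegral (ε s l h A)
  ε-columnMinorsIntegral s l h A minors J inc with any? (λ b → J b ≟ l)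
  ... | no l∉J = Integral-resp (det-cong unchanged) (minors J inc)
    where
      unchanged : ∀ a b → columns A J a b ≈ columns (ε s l h A) J a b
      unchanged a b = ≡⇒≈ (≡.sym (ε-offColumn s l h A a (J b) (λ e → l∉J (b , e))))
  ... | yes (b₀ , J₀≡l) = Integral-resp (sym det≈)
        (Integral-+ (minors J inc) (Integral-* (Integral-ι h) (ColumnMinorsIntegral-updateAt A minors J inc b₀ s)))
    where
      J′ = updateAt J b₀ (const s)
      J≢l : ∀ b → b ≢ b₀ → J b ≢ l
      J≢l b b≢b₀ e = b≢b₀ (strictlyIncreasing⇒injective inc (≡.trans e (≡.sym J₀≡l)))
      offB : ∀ a b → b ≢ b₀ → columns (ε s l h A) J a b ≈ columns A J a b
      offB a b b≢b₀ = ≡⇒≈ (ε-offColumn s l h A a (J b) (J≢l b b≢b₀))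
      offC : ∀ a b → b ≢ b₀ → columns (ε s l h A) J a b ≈ columns A J′ a b
      offC a b b≢b₀ = trans (offB a b b≢b₀) (≡⇒≈ (≡.cong (A a) (≡.sym (updateAt-minimal b b₀ J b≢b₀))))
      onB₀ : ∀ a → columns (ε s l h A) J a b₀ ≈ 1# * columns A J a b₀ + ι h * columns A J′ a b₀
      onB₀ a rewrite J₀≡l =
        trans (ε-onColumn s l h A a) (+-cong (sym (*-identityˡ _)) (*-congˡ (≡⇒≈ (≡.cong (A a) (≡.sym (updateAt-updates b₀ J))))))
      det≈ : det (columns (ε s l h A) J) ≈ det (columns A J) + ι h * det (columns A J′)
      det≈ = trans (det-linearColumn _ _ _ b₀ 1# (ι h) offB offC onB₀) (+-congʳ (*-identityˡ _))

  columnScale : ∀ {q} → Fin q → Carrier → Fin q → Carrier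
  columnScale s u j with j ≟ s
  ... | yes _ = u
  ... | no _  = 1#

  γ-row₀ : ∀ {p q} (s : Fin q) m u (M : Matrix (suc p) q) j →
    γ s m u M zero j ≈ ι m * (M zero j * columnScale s u j)
  γ-row₀ s m u M j with j ≟ s
  ... | yes _ = refl
  ... | no _  = refl

  γ-row : ∀ {p q} (s : Fin q) m u (M : Matrix (suc p) q) i j → i ≢ zero →
    γ s m u M i j ≈ M i j * columnScale s u j
  γ-row s m u M zero    j i≢0 = contradiction ≡.refl i≢0
  γ-row s m u M (suc i) j _ with j ≟ s
  ... | yes _ = *-identityˡ _
  ... | no _  = *-identityˡ _

  γ-columnMinorsIntegral : ∀ {n q} (s : Fin q) m u → ι m * u ≈ 1# → (A B : Matrix (suc n) q) →
    (∀ j → B zero j ≈ ι m * (A zero j * columnScale s u j)) →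
    (∀ a j → B (suc a) j ≈ A (suc a) j * columnScale s u j) →
    ColumnMinorsIntegral A → ColumnMinorsIntegral B
  γ-columnMinorsIntegral {n} s m u mu≈1 A B row₀ rows minors J inc =
    Integral-resp (sym detB≈) scaledIntegral
    where
      scaled : Matrix (suc n) (suc n)
      scaled a b = A a (J b) * columnScale s u (J b)
      detB≈ : det (columns B J) ≈ ι m * det scaled
      detB≈ = det-scaleRow₀ (columns B J) scaled (ι m) (row₀ ∘ J) (λ a b → rows a (J b))
      scaledIntegral : Integral (ι m * det scaled)
      scaledIntegral with any? (λ b → J b ≟ s)
      ... | no s∉J = Integral-resp (*-congˡ (sym (det-cong unscaled))) (Integral-* (Integral-ι m) (minors J inc))
        where
          unscaled : ∀ a b → scaled a b ≈ columns A J a b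
          unscaled a b with J b ≟ s
          ... | yes Jᵦ≡s = contradiction (b , Jᵦ≡s) s∉J
          ... | no _     = *-identityʳ _
      ... | yes (b₀ , J₀≡s) = Integral-resp (sym (begin
            ι m * det scaled                ≈⟨ *-congˡ (det-scaleColumn scaled (columns A J) b₀ u unscaled onB₀) ⟩
            ι m * (u * det (columns A J))   ≈⟨ *-assoc _ _ _ ⟨
            (ι m * u) * det (columns A J)   ≈⟨ trans (*-congʳ mu≈1) (*-identityˡ _) ⟩
            det (columns A J)               ∎)) (minors J inc)
        where
          unscaled : ∀ a b → b ≢ b₀ → scaled a b ≈ columns A J a b
          unscaled a b b≢b₀ with J b ≟ s
          ... | yes Jᵦ≡s = contradiction (strictlyIncreasing⇒injective inc (≡.trans Jᵦ≡s (≡.sym J₀≡s))) b≢b₀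
          ... | no _     = *-identityʳ _
          onB₀ : ∀ a → scaled a b₀ ≈ u * columns A J a b₀
          onB₀ a with J b₀ ≟ s
          ... | yes _   = *-comm _ _
          ... | no J₀≢s = contradiction J₀≡s J₀≢s

  FirstRowMinorsIntegral⇒ColumnMinorsIntegral : ∀ {p q k} {M : Matrix (suc p) q} →
    FirstRowMinorsIntegral k M → ∀ {I} → StrictlyIncreasing I → ∃ (λ a → I a ≡ zero) → ColumnMinorsIntegral (M ∘ I)
  FirstRowMinorsIntegral⇒ColumnMinorsIntegral H incI I∋0 J incJ = IsInteger⇒Integral (H _ J incI incJ I∋0)

  γ-firstRowMinorsIntegral : ∀ {p q} k (s : Fin q) m u → ι m * u ≈ 1# → (M : Matrix (suc p) q) →
    FirstRowMinorsIntegral k M → FirstRowMinorsIntegral k (γ s m u M)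
  γ-firstRowMinorsIntegral zero    s m u mu≈1 M H I J incI incJ (() , _)
  γ-firstRowMinorsIntegral (suc k) s m u mu≈1 M H I J incI incJ I∋0 = Integral⇒IsInteger
    (γ-columnMinorsIntegral s m u mu≈1 (M ∘ I) (γ s m u M ∘ I) row₀ rows
      (FirstRowMinorsIntegral⇒ColumnMinorsIntegral {M = M} H incI I∋0) J incJ)
    where
      row₀ : ∀ j → γ s m u M (I zero) j ≈ ι m * (M (I zero) j * columnScale s u j)
      row₀ j rewrite strictlyIncreasing-head≡zero incI I∋0 = γ-row₀ s m u M j
      rows : ∀ a j → γ s m u M (I (suc a)) j ≈ M (I (suc a)) j * columnScale s u j
      rows a j = γ-row s m u M (I (suc a)) j (strictlyIncreasing-tail≢zero incI a)

  ε-firstRowMinorsIntegral : ∀ {p q} k (s l : Fin q) h (M : Matrix (suc p) q) →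
    FirstRowMinorsIntegral k M → FirstRowMinorsIntegral k (ε s l h M)
  ε-firstRowMinorsIntegral zero    s l h M H I J incI incJ (() , _)
  ε-firstRowMinorsIntegral (suc k) s l h M H I J incI incJ I∋0 = Integral⇒IsInteger
    (Integral-resp (det-cong restricted)
      (ε-columnMinorsIntegral s l h (M ∘ I) (FirstRowMinorsIntegral⇒ColumnMinorsIntegral {M = M} H incI I∋0) J incJ))
    where
      restricted : ∀ a b → ε s l h (M ∘ I) a (J b) ≈ ε s l h M (I a) (J b)
      restricted a b with J b ≟ l
      ... | yes _ = refl
      ... | no _  = refl

theorem10 : {c ℓ : Level} (R : CommutativeRing c ℓ) {p q : ℕ}
    (M : MatrixOps.Matrix R (suc p) q) (k : ℕ) → k ≥ 1 →
    (ρ : MatrixOps.ColOp R q) →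
    MatrixOps.FirstRowMinorsIntegral R k M →
    MatrixOps.FirstRowMinorsIntegral R k (MatrixOps.apply R ρ M)
theorem10 R M k _ (MatrixOps.gammaOp s m _ u mu≈1) = γ-firstRowMinorsIntegral R k s m u mu≈1 M
theorem10 R M k _ (MatrixOps.epsOp s l _ h)        = ε-firstRowMinorsIntegral R k s l h M
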